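{- Let $t\ge 1$ and $s\ge 1$ be integers. Then $\chi_p(P_{2t}\Diamond_2 C_{4s+2})\le 4$ if $1\le t\le 2$, and $\chi_p(P_{2t}\Diamond_2 C_{4s+2})\le 5$ if $t\ge 3$. Moreover, equality holds for $t\in\{1,2\}$.
   Context: A packing $k$-coloring of a graph $H$ is a map $c:V(H)\to\{1,\ldots,k\}$ such that any two distinct vertices $u,v$ with $c(u)=c(v)=i$ satisfy $d_H(u,v)\ge i+1$. The packing chromatic number $\chi_p(H)$ is the least such $k$. $P_m$ denotes the path $v_1\cdots v_m$ and $C_n$ the cycle on $n$ vertices. Path-aligned product: for positive integers $\ell\mid m$ and a connected vertex-transitive graph $G$ containing $P_\ell$ as a subgraph, $P_m\Diamond_\ell G$ is formed from the path $P_m=v_1\cdots v_m$ and $m/\ell$ pairwise disjoint copies of $G$, where for each $1\le i\le m/\ell$ the consecutive path vertices $v_{(i-1)\ell+1},\ldots,v_{i\ell}$ are identified, in order, with the vertices of a path $P_\ell$ (i.e. $\ell$ consecutive cycle vertices when $G$ is a cycle) in the $i$-th copy of $G$. -}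

module Defs where

open import Data.Nat using (ℕ; zero; suc; _+_; _*_; _≤_; _<_)
open import Data.Fin using (Fin; toℕ)
open import Data.Product using (Σ; _×_; _,_)
open import Relation.Binary.PropositionalEquality using (_≡_; _≢_)
open import Relation.Nullary using (¬_)

record Graph : Set₁ where
  field
    V   : Set
    Adj : V → V → Set

open Graph public

data Walk (G : Graph) : V G → V G → ℕ → Set where
  here : ∀ {u} → Walk G u u 0
  step : ∀ {u v w n} → Adj G u v → Walk G v w n → Walk G u w (suc n)

-- d_H(u,v) ≥ m : every u–v walk (hence every u–v path) has length ≥ m,
-- i.e. the minimum path length (the distance) is at least m.
DistAtLeast : (G : Graph) → V G → V G → ℕ → Set
DistAtLeast G u v m = ∀ {ℓ} → Walk G u v ℓ → m ≤ ℓ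

IsPackingColoring : (G : Graph) → ℕ → (V G → ℕ) → Set
IsPackingColoring G k c =
  (∀ v → 1 ≤ c v × c v ≤ k) ×
  (∀ u v → u ≢ v → c u ≡ c v → DistAtLeast G u v (suc (c u)))

PackingColorable : Graph → ℕ → Set
PackingColorable G k = Σ (V G → ℕ) (IsPackingColoring G k)

PackingChromaticNumberIs : Graph → ℕ → Set
PackingChromaticNumberIs G k =
  PackingColorable G k × (∀ j → j < k → ¬ PackingColorable G j)

-- Vertex (i , a): vertex a of the i-th copy
-- of C_n (0-based).  In copy i, cycle vertices 0 and 1 are identified with
-- path vertices v_{2i+1}, v_{2i+2} (1-based); the remaining path edges
-- v_{2i+2} v_{2i+3} join (i,1) to (i+1,0).
data ProdAdj (t n : ℕ) : Fin t × Fin n → Fin t × Fin n → Set where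
  cyc⁺  : ∀ i a b → toℕ b ≡ suc (toℕ a) → ProdAdj t n (i , a) (i , b)
  cyc⁻  : ∀ i a b → toℕ a ≡ suc (toℕ b) → ProdAdj t n (i , a) (i , b)
  wrap⁺ : ∀ i a b → suc (toℕ a) ≡ n → toℕ b ≡ 0 → ProdAdj t n (i , a) (i , b)
  wrap⁻ : ∀ i a b → toℕ a ≡ 0 → suc (toℕ b) ≡ n → ProdAdj t n (i , a) (i , b)
  path⁺ : ∀ i j a b → toℕ j ≡ suc (toℕ i) → toℕ a ≡ 1 → toℕ b ≡ 0 →
          ProdAdj t n (i , a) (j , b)
  path⁻ : ∀ i j a b → toℕ i ≡ suc (toℕ j) → toℕ a ≡ 0 → toℕ b ≡ 1 →
          ProdAdj t n (i , a) (j , b)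

PathCycleProd : ℕ → ℕ → Graph
PathCycleProd t n = record { V = Fin t × Fin n ; Adj = ProdAdj t n }

{-# OPTIONS --safe #-}
-- Packing colourings restrict to subgraphs, so it suffices to colour t = 2 with
-- 4 colours and every t with 5, and to show that a single copy of C_n has no
-- packing 3-colouring.
-- Upper bounds: a copy gets colour 1 on even positions, 2 and 3 alternately on
-- the other odd positions and 4 or 5 on position n - 1, the two variants
-- alternating along the path; for t = 2, copy 0 instead ends in 2 1 4 2.  Equal
-- colours are far enough apart by an explicit distance formula, which bounds
-- the length of every walk because it changes by at most one along each edge.
-- Lower bound: in a packing 3-colouring of C_n, each window of three consecutive
-- colours has a phase in ℤ/4 that advances by one at every step, so a full turn
-- moves it by n ≡ 2 (mod 4), which is impossible.
module Submission where

open import Defs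
open import Data.Bool using (Bool; true; false; not)
open import Data.Bool.Properties using (not-¬; ¬-not; not-involutive) renaming (_≟_ to _≟ᵇ_)
open import Data.Fin using (Fin; zero; suc; toℕ; inject≤; #_) renaming (_≟_ to _≟ᶠ_)
open import Data.Fin.Properties using (toℕ<n; toℕ-injective; toℕ-inject≤; inject≤-injective; toℕ-fromℕ<; all?)
open import Data.Nat using (ℕ; zero; suc; NonZero; _+_; _*_; _∸_; _⊓_; ∣_-_∣; _≤_; _<_; z≤n; s≤s; _≟_; _<?_; _%_)
open import Data.Nat.DivMod using (_mod_; %-distribˡ-+; m<n⇒m%n≡m; m≤n⇒[n∸m]%m≡n%m; [m+n]%n≡m%n; m%n<n)
open import Data.Nat.Properties
open import Data.Product using (∃; _×_; _,_; proj₁; proj₂)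
open import Data.Sum using (_⊎_; inj₁; inj₂)
open import Function using (_∘_)
open import Relation.Binary.PropositionalEquality
open import Relation.Binary.Definitions using (tri<; tri≈; tri>)
open import Relation.Nullary using (¬_; Dec; yes; no; contradiction)
open import Relation.Nullary.Decidable using (toWitness; _×-dec_; _→-dec_)

module _ {G : Graph} where

  Walk-snoc : ∀ {u v w ℓ} → Walk G u v ℓ → Adj G v w → Walk G u w (suc ℓ)
  Walk-snoc here        e = step e here
  Walk-snoc (step e′ p) e = step e′ (Walk-snoc p e)

  Walk-reverse : (∀ {x y} → Adj G x y → Adj G y x) → ∀ {u v ℓ} → Walk G u v ℓ → Walk G v u ℓ
  Walk-reverse adj-sym here       = here
  Walk-reverse adj-sym (step e p) = Walk-snoc (Walk-reverse adj-sym p) (adj-sym e)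

OneLipschitz : (G : Graph) → (V G → ℕ) → Set
OneLipschitz G F = ∀ {x y} → Adj G x y → F x ≤ suc (F y)

OneLipschitz-walk : ∀ {G F} → OneLipschitz G F → ∀ {u v ℓ} → Walk G u v ℓ → F u ≤ ℓ + F v
OneLipschitz-walk lip here       = ≤-refl
OneLipschitz-walk lip (step e p) = ≤-trans (lip e) (s≤s (OneLipschitz-walk lip p))

Walk-map : ∀ {G H} (f : V G → V H) → (∀ {x y} → Adj G x y → Adj H (f x) (f y)) →
           ∀ {u v ℓ} → Walk G u v ℓ → Walk H (f u) (f v) ℓ
Walk-map f f-adj here       = here
Walk-map f f-adj (step e p) = step (f-adj e) (Walk-map f f-adj p)

PackingColorable-subgraph : ∀ {G H} (f : V G → V H) → (∀ {x y} → f x ≡ f y → x ≡ y) →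
                            (∀ {x y} → Adj G x y → Adj H (f x) (f y)) →
                            ∀ {k} → PackingColorable H k → PackingColorable G k
PackingColorable-subgraph f f-inj f-adj (c , range , far) =
  c ∘ f , range ∘ f , λ u v u≢v same p → far (f u) (f v) (u≢v ∘ f-inj) same (Walk-map f f-adj p)

PackingColorable-mono : ∀ {G j k} → j ≤ k → PackingColorable G j → PackingColorable G k
PackingColorable-mono j≤k (c , range , far) =
  c , (λ v → proj₁ (range v) , ≤-trans (proj₂ (range v)) j≤k) , far

even : ℕ → Bool
even zero          = true
even (suc zero)    = false
even (suc (suc a)) = even a

secondBit : ℕ → Bool
secondBit zero          = false
secondBit (suc zero)    = false
secondBit (suc (suc a)) = not (secondBit a)

even-suc : ∀ a → even (suc a) ≡ not (even a)
even-suc zero          = refl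
even-suc (suc zero)    = refl
even-suc (suc (suc a)) = even-suc a

even-4* : ∀ s → even (4 * s) ≡ true
even-4* zero    = refl
even-4* (suc s) = trans (cong even (*-suc 4 s)) (even-4* s)

secondBit-1+4* : ∀ s → secondBit (1 + 4 * s) ≡ false
secondBit-1+4* zero    = refl
secondBit-1+4* (suc s) =
  trans (cong (secondBit ∘ suc) (*-suc 4 s)) (trans (not-involutive _) (secondBit-1+4* s))

even⇒≢suc : ∀ {a b} → even a ≡ even b → suc a ≢ b
even⇒≢suc {a} ea≡eb refl = not-¬ refl (trans ea≡eb (even-suc a))

even-gap : ∀ {a b} → even a ≡ even b → a < b → 2 + a ≤ b
even-gap ea≡eb a<b = ≤∧≢⇒< a<b (even⇒≢suc ea≡eb)

secondBit-gap : ∀ {a b} → even a ≡ false → even b ≡ false → secondBit a ≡ secondBit b → a < b → 4 + a ≤ b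
secondBit-gap {a} ea eb sa≡sb a<b =
  ≤∧≢⇒< (≤∧≢⇒< (even-gap (trans ea (sym eb)) a<b) 2+a≢b) (even⇒≢suc (trans ea (sym eb)))
  where
  2+a≢b : 2 + a ≢ _
  2+a≢b refl = not-¬ refl sa≡sb

even⇒≢1 : ∀ {a} → even a ≡ true → a ≢ 1
even⇒≢1 () refl

secondBit⇒≢1 : ∀ {a} → secondBit a ≡ true → a ≢ 1
secondBit⇒≢1 () refl

odd⇒≥1 : ∀ {a} → even a ≡ false → 1 ≤ a
odd⇒≥1 {suc a} _ = s≤s z≤n

odd⇒≡1⊎≥3 : ∀ {a} → even a ≡ false → a ≡ 1 ⊎ 3 ≤ a
odd⇒≡1⊎≥3 {1}               _ = inj₁ refl
odd⇒≡1⊎≥3 {suc (suc (suc a))} _ = inj₂ (s≤s (s≤s (s≤s z≤n)))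

odd∧secondBit⇒≥3 : ∀ {a} → even a ≡ false → secondBit a ≡ true → 3 ≤ a
odd∧secondBit⇒≥3 {suc (suc (suc a))} _ _ = s≤s (s≤s (s≤s z≤n))

cycleDist : ℕ → ℕ → ℕ → ℕ
cycleDist n a b = ∣ a - b ∣ ⊓ (n ∸ ∣ a - b ∣)

cycleDist-comm : ∀ n a b → cycleDist n a b ≡ cycleDist n b a
cycleDist-comm n a b rewrite ∣-∣-comm a b = refl

cycleDist-self : ∀ n a → cycleDist n a a ≡ 0
cycleDist-self n a rewrite ∣n-n∣≡0 a = refl

cycleDist-flip : ∀ {n d} a b → d ≤ cycleDist n b a → d ≤ cycleDist n a b
cycleDist-flip {n} a b = subst (_ ≤_) (cycleDist-comm n b a)

cycleDist-≥ : ∀ {n a b d} → d + a ≤ b → d + b ≤ n + a → d ≤ cycleDist n a b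
cycleDist-≥ {n} {a} {b} {d} d+a≤b d+b≤n+a = ⊓-glb short long
  where
  a≤b : a ≤ b
  a≤b = m+n≤o⇒n≤o d d+a≤b
  ∣a-b∣≡b∸a : ∣ a - b ∣ ≡ b ∸ a
  ∣a-b∣≡b∸a = m≤n⇒∣m-n∣≡n∸m a≤b
  short : d ≤ ∣ a - b ∣
  short rewrite ∣a-b∣≡b∸a = m+n≤o⇒m≤o∸n d d+a≤b
  long : d ≤ n ∸ ∣ a - b ∣
  long rewrite ∣a-b∣≡b∸a = m+n≤o⇒m≤o∸n d (+-cancelʳ-≤ a _ _ (begin
    d + (b ∸ a) + a ≡⟨ +-assoc d (b ∸ a) a ⟩
    d + (b ∸ a + a) ≡⟨ cong (d +_) (m∸n+n≡m a≤b) ⟩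
    d + b           ≤⟨ d+b≤n+a ⟩
    n + a           ∎))
    where open ≤-Reasoning

cycleDist-≥′ : ∀ {n a b d} → d + b ≤ a → d + a ≤ n + b → d ≤ cycleDist n a b
cycleDist-≥′ {a = a} {b} d+b≤a d+a≤n+b = cycleDist-flip a b (cycleDist-≥ d+b≤a d+a≤n+b)

cycleDist-≥-class : ∀ {n d} {P : ℕ → Set} → (∀ {a b} → P a → P b → a < b → d + a ≤ b × d + b ≤ n + a) →
                    ∀ {a b} → P a → P b → a ≢ b → d ≤ cycleDist n a b
cycleDist-≥-class ordered {a} {b} pa pb a≢b with <-cmp a b
... | tri< a<b _ _ = let d+a≤b , d+b≤n+a = ordered pa pb a<b in cycleDist-≥ d+a≤b d+b≤n+a
... | tri≈ _ a≡b _ = contradiction a≡b a≢b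
... | tri> _ _ b<a = let d+b≤a , d+a≤n+b = ordered pb pa b<a in cycleDist-≥′ d+b≤a d+a≤n+b

cycleDist-pos : ∀ {n a b} → a < n → b < n → a ≢ b → 1 ≤ cycleDist n a b
cycleDist-pos {n} = cycleDist-≥-class (λ {a} _ b<n a<b → a<b , ≤-trans b<n (m≤m+n n a))

private
  ∣-∣-suc : ∀ c a → ∣ c - suc a ∣ ≤ suc ∣ c - a ∣ × ∣ c - a ∣ ≤ suc ∣ c - suc a ∣
  ∣-∣-suc zero    a       = ≤-refl , ≤-trans (n≤1+n a) (n≤1+n _)
  ∣-∣-suc (suc c) zero    rewrite ∣-∣-identityʳ c = ≤-trans (n≤1+n c) (n≤1+n _) , ≤-refl
  ∣-∣-suc (suc c) (suc a) = ∣-∣-suc c a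

  ∸-near : ∀ n x y → y ≤ suc x → n ∸ x ≤ suc (n ∸ y)
  ∸-near zero    x       y       _         rewrite 0∸n≡0 x = z≤n
  ∸-near (suc n) zero    zero    _         = n≤1+n _
  ∸-near (suc n) zero    (suc zero) _      = ≤-refl
  ∸-near (suc n) zero    (suc (suc y)) (s≤s ())
  ∸-near (suc n) (suc x) zero    _         = ≤-trans (m∸n≤m n x) (≤-trans (n≤1+n n) (n≤1+n _))
  ∸-near (suc n) (suc x) (suc y) (s≤s y≤x) = ∸-near n x y y≤x

  ⊓∸-near : ∀ n x y → x ≤ suc y → y ≤ suc x → x ⊓ (n ∸ x) ≤ suc (y ⊓ (n ∸ y))
  ⊓∸-near n x y x≤1+y y≤1+x = ⊓-mono-≤ x≤1+y (∸-near n x y y≤1+x)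

  ⊓-swap-near : ∀ x y → x ⊓ suc y ≤ suc (y ⊓ suc x)
  ⊓-swap-near x y = ⊓-glb (m⊓n≤n x (suc y)) (≤-trans (m⊓n≤m x (suc y)) (≤-trans (n≤1+n x) (n≤1+n _)))

cycleDist-suc : ∀ n c a →
                cycleDist n c a ≤ suc (cycleDist n c (suc a)) × cycleDist n c (suc a) ≤ suc (cycleDist n c a)
cycleDist-suc n c a with ∣-∣-suc c a
... | up , down = ⊓∸-near n _ _ down up , ⊓∸-near n _ _ up down

cycleDist-wrap : ∀ m c → c ≤ m →
                 cycleDist (suc m) c m ≤ suc (cycleDist (suc m) c 0) × cycleDist (suc m) c 0 ≤ suc (cycleDist (suc m) c m)
cycleDist-wrap m c c≤m
  rewrite ∣-∣-identityʳ c | +-∸-assoc 1 c≤m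
        | m≤n⇒∣m-n∣≡n∸m c≤m | +-∸-assoc 1 (m∸n≤m m c) | m∸[m∸n]≡n c≤m
  = ⊓-swap-near (m ∸ c) c , ⊓-swap-near c (m ∸ c)

-- The graph P_{2t} ◇₂ C_n and its distances

ProdAdj-sym : ∀ {t n x y} → ProdAdj t n x y → ProdAdj t n y x
ProdAdj-sym (cyc⁺ i a b e)          = cyc⁻ i b a e
ProdAdj-sym (cyc⁻ i a b e)          = cyc⁺ i b a e
ProdAdj-sym (wrap⁺ i a b e e′)      = wrap⁻ i b a e′ e
ProdAdj-sym (wrap⁻ i a b e e′)      = wrap⁺ i b a e′ e
ProdAdj-sym (path⁺ i j a b e ea eb) = path⁻ j i b a e eb ea
ProdAdj-sym (path⁻ i j a b e ea eb) = path⁺ j i b a e eb ea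

PathCycleProd-mono : ∀ {t t′ n k} → t ≤ t′ →
                     PackingColorable (PathCycleProd t′ n) k → PackingColorable (PathCycleProd t n) k
PathCycleProd-mono {t} {t′} {n} t≤t′ = PackingColorable-subgraph embed embed-injective embed-adj
  where
  inj : Fin t → Fin t′
  inj i = inject≤ i t≤t′
  embed : Fin t × Fin n → Fin t′ × Fin n
  embed (i , a) = inj i , a
  embed-injective : ∀ {x y} → embed x ≡ embed y → x ≡ y
  embed-injective {i , a} {j , b} same =
    cong₂ _,_ (inject≤-injective t≤t′ t≤t′ i j (cong proj₁ same)) (cong proj₂ same)
  lift : ∀ {i j} → toℕ j ≡ suc (toℕ i) → toℕ (inj j) ≡ suc (toℕ (inj i))
  lift {i} {j} e = trans (toℕ-inject≤ j t≤t′) (trans e (cong suc (sym (toℕ-inject≤ i t≤t′))))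
  embed-adj : ∀ {x y} → ProdAdj t n x y → ProdAdj t′ n (embed x) (embed y)
  embed-adj (cyc⁺ i a b e)          = cyc⁺ (inj i) a b e
  embed-adj (cyc⁻ i a b e)          = cyc⁻ (inj i) a b e
  embed-adj (wrap⁺ i a b e e′)      = wrap⁺ (inj i) a b e e′
  embed-adj (wrap⁻ i a b e e′)      = wrap⁻ (inj i) a b e e′
  embed-adj (path⁺ i j a b e ea eb) = path⁺ (inj i) (inj j) a b (lift e) ea eb
  embed-adj (path⁻ i j a b e ea eb) = path⁻ (inj i) (inj j) a b (lift e) ea eb

Near : ℕ → ℕ → Set
Near x y = x ≤ suc y × y ≤ suc x

Near-suc : ∀ x → Near x (suc x)
Near-suc x = ≤-trans (n≤1+n x) (n≤1+n _) , ≤-refl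

Near-sym : ∀ {x y} → Near x y → Near y x
Near-sym (x≤1+y , y≤1+x) = y≤1+x , x≤1+y

+-near : ∀ k {x y} → x ≤ suc y → k + x ≤ suc (k + y)
+-near k {y = y} x≤1+y = ≤-trans (+-monoʳ-≤ k x≤1+y) (≤-reflexive (+-suc k y))

module ProductDistance (m : ℕ) where

  n : ℕ
  n = 2 + m

  -- A shortest path from (I , A) to copy i enters that copy at its cycle
  -- vertex entry A I i after offset A I i steps.
  entry : (A I i : ℕ) → ℕ
  entry A zero    zero    = A
  entry A zero    (suc i) = 0
  entry A (suc I) zero    = 1
  entry A (suc I) (suc i) = entry A I i

  offset : (A I i : ℕ) → ℕ
  offset A (suc I)       (suc i)       = offset A I i
  offset A zero          zero          = 0
  offset A zero          (suc zero)    = suc (cycleDist n A 1)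
  offset A zero          (suc (suc i)) = 2 + offset A zero (suc i)
  offset A (suc zero)    zero          = suc (cycleDist n A 0)
  offset A (suc (suc I)) zero          = 2 + offset A (suc I) zero

  prodDist : (A I i b : ℕ) → ℕ
  prodDist A I i b = offset A I i + cycleDist n (entry A I i) b

  distFrom : ∀ {t} → Fin t × Fin n → Fin t × Fin n → ℕ
  distFrom (I , A) (i , b) = prodDist (toℕ A) (toℕ I) (toℕ i) (toℕ b)

  entry<n : ∀ {A} I i → A < n → entry A I i < n
  entry<n zero    zero    A<n = A<n
  entry<n zero    (suc i) _   = s≤s z≤n
  entry<n (suc I) zero    _   = s≤s (s≤s z≤n)
  entry<n (suc I) (suc i) A<n = entry<n I i A<n

  prodDist-self : ∀ A I → prodDist A I I A ≡ 0
  prodDist-self A zero    = cycleDist-self n A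
  prodDist-self A (suc I) = prodDist-self A I

  prodDist-shift : ∀ A I k b → prodDist A I (I + k) b ≡ prodDist A 0 k b
  prodDist-shift A zero    k b = refl
  prodDist-shift A (suc I) k b = prodDist-shift A I k b

  prodDist-far : ∀ A k b → 3 + (cycleDist n A 1 + cycleDist n 0 b) ≤ prodDist A 0 (2 + k) b
  prodDist-far A k b = s≤s (s≤s (+-monoˡ-≤ (cycleDist n 0 b) (offset-≥ k)))
    where
    offset-≥ : ∀ k → suc (cycleDist n A 1) ≤ offset A 0 (suc k)
    offset-≥ zero    = ≤-refl
    offset-≥ (suc k) = ≤-trans (offset-≥ k) (m≤n+m _ 2)

  prodDist-path : ∀ A I i → Near (prodDist A I i 1) (prodDist A I (suc i) 0)
  prodDist-path A zero          zero    rewrite +-identityʳ (cycleDist n A 1) = Near-suc _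
  prodDist-path A zero          (suc i) rewrite +-identityʳ (offset A 0 (suc i)) | +-comm (offset A 0 (suc i)) 1 = Near-suc _
  prodDist-path A (suc zero)    zero    rewrite +-identityʳ (cycleDist n A 0) = Near-sym (Near-suc _)
  prodDist-path A (suc (suc I)) zero    rewrite +-identityʳ (offset A (suc I) 0) | +-comm (offset A (suc I) 0) 1 = Near-sym (Near-suc _)
  prodDist-path A (suc I)       (suc i) = prodDist-path A I i

  distFrom-lipschitz : ∀ {t} (p : Fin t × Fin n) → OneLipschitz (PathCycleProd t n) (distFrom p)
  distFrom-lipschitz (I , A) (cyc⁺ i a b b≡1+a) rewrite b≡1+a =
    +-near _ (proj₁ (cycleDist-suc n (entry (toℕ A) (toℕ I) (toℕ i)) (toℕ a)))
  distFrom-lipschitz (I , A) (cyc⁻ i a b a≡1+b) rewrite a≡1+b =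
    +-near _ (proj₂ (cycleDist-suc n (entry (toℕ A) (toℕ I) (toℕ i)) (toℕ b)))
  distFrom-lipschitz (I , A) (wrap⁺ i a b 1+a≡n b≡0) rewrite suc-injective 1+a≡n | b≡0 =
    +-near _ (proj₁ (cycleDist-wrap (suc m) _ (≤-pred (entry<n (toℕ I) (toℕ i) (toℕ<n A)))))
  distFrom-lipschitz (I , A) (wrap⁻ i a b a≡0 1+b≡n) rewrite a≡0 | suc-injective 1+b≡n =
    +-near _ (proj₂ (cycleDist-wrap (suc m) _ (≤-pred (entry<n (toℕ I) (toℕ i) (toℕ<n A)))))
  distFrom-lipschitz (I , A) (path⁺ i j a b j≡1+i a≡1 b≡0) rewrite j≡1+i | a≡1 | b≡0 =
    proj₁ (prodDist-path (toℕ A) (toℕ I) (toℕ i))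
  distFrom-lipschitz (I , A) (path⁻ i j a b i≡1+j a≡0 b≡1) rewrite i≡1+j | a≡0 | b≡1 =
    proj₂ (prodDist-path (toℕ A) (toℕ I) (toℕ j))

  distFrom-≤-walk : ∀ {t u v ℓ} → Walk (PathCycleProd t n) u v ℓ → distFrom v u ≤ ℓ
  distFrom-≤-walk {v = j , b} {ℓ} p = begin
    distFrom (j , b) _            ≤⟨ OneLipschitz-walk (distFrom-lipschitz (j , b)) p ⟩
    ℓ + distFrom (j , b) (j , b)  ≡⟨ cong (ℓ +_) (prodDist-self (toℕ b) (toℕ j)) ⟩
    ℓ + 0                         ≡⟨ +-identityʳ ℓ ⟩
    ℓ                             ∎
    where open ≤-Reasoning

  -- prodDist (toℕ a) 0 k (toℕ b) is the distance between (i , a) and (j , b).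
  Separated : (t : ℕ) → (Fin t × Fin n → ℕ) → Set
  Separated t c = ∀ {i j a b} k → toℕ j ≡ toℕ i + k → (i , a) ≢ (j , b) → c (i , a) ≡ c (j , b) →
                  c (i , a) < prodDist (toℕ a) 0 k (toℕ b)

  Separated⇒PackingColorable : ∀ {t k} (c : Fin t × Fin n → ℕ) → (∀ v → 1 ≤ c v × c v ≤ k) →
                               Separated t c → PackingColorable (PathCycleProd t n) k
  Separated⇒PackingColorable {t} c range sep = c , range , far
    where
    ordered : ∀ {i j a b ℓ} → toℕ i ≤ toℕ j → (i , a) ≢ (j , b) → c (i , a) ≡ c (j , b) →
              Walk (PathCycleProd t n) (j , b) (i , a) ℓ → c (i , a) < ℓ
    ordered {i} {j} {a} {b} {ℓ} i≤j u≢v same p with m≤n⇒∃[o]m+o≡n i≤j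
    ... | k , i+k≡j = begin-strict
      c (i , a)                                    <⟨ sep k (sym i+k≡j) u≢v same ⟩
      prodDist (toℕ a) 0 k (toℕ b)                 ≡⟨ prodDist-shift (toℕ a) (toℕ i) k (toℕ b) ⟨
      prodDist (toℕ a) (toℕ i) (toℕ i + k) (toℕ b) ≡⟨ cong (λ x → prodDist (toℕ a) (toℕ i) x (toℕ b)) i+k≡j ⟩
      distFrom (i , a) (j , b)                     ≤⟨ distFrom-≤-walk p ⟩
      ℓ                                            ∎
      where open ≤-Reasoning
    far : ∀ u v → u ≢ v → c u ≡ c v → DistAtLeast (PathCycleProd t n) u v (suc (c u))
    far (i , a) (j , b) u≢v same p with ≤-total (toℕ i) (toℕ j)
    ... | inj₁ i≤j = ordered i≤j u≢v same (Walk-reverse ProdAdj-sym p)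
    ... | inj₂ j≤i = subst (_< _) (sym same) (ordered j≤i (u≢v ∘ sym) (sym same) p)

-- Packing colourings of P_{2t} ◇₂ C_n for n = 6 + 4s

sameClass : ∀ {P Q : ℕ → Set} (x : ∃ P) (y : ∃ Q) → proj₁ x ≡ proj₁ y → P (proj₁ x) × Q (proj₁ x)
sameClass (c , p) (.c , q) refl = p , q


module Colourings (s : ℕ) where

  open ProductDistance (4 + 4 * s)

  K : ℕ
  K = 4 * s

  1<n : 1 < n
  1<n = s≤s (s≤s z≤n)

  even-n : even n ≡ true
  even-n = even-4* s

  room-even : ∀ {b} → b < n → even b ≡ true → 2 + b ≤ n
  room-even b<n eb = even-gap (trans eb (sym even-n)) b<n

  room-odd : ∀ {a} → a < n → even a ≡ false → 1 + a ≢ n → 3 + a ≤ n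
  room-odd {a} a<n ea 1+a≢n =
    ≤∧≢⇒< (≤∧≢⇒< a<n 1+a≢n) (even⇒≢suc (trans (even-suc a) (trans (cong not ea) (sym even-n))))

  cycleDist-from-0 : ∀ {b d} → d ≤ b → d + b ≤ n → d ≤ cycleDist n 0 b
  cycleDist-from-0 {b} {d} d≤b d+b≤n =
    cycleDist-≥ (subst (_≤ b) (sym (+-identityʳ d)) d≤b) (subst (d + b ≤_) (sym (+-identityʳ n)) d+b≤n)

  evens-apart : ∀ {a b} → a < n → b < n → even a ≡ true → even b ≡ true → a ≢ b → 2 ≤ cycleDist n a b
  evens-apart a<n b<n ea eb = cycleDist-≥-class ordered (a<n , ea) (b<n , eb)
    where
    ordered : ∀ {a b} → a < n × even a ≡ true → b < n × even b ≡ true → a < b → 2 + a ≤ b × 2 + b ≤ n + a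
    ordered {a} (_ , ea) (b<n , eb) a<b = even-gap (trans ea (sym eb)) a<b , ≤-trans (room-even b<n eb) (m≤m+n n a)

  odds-apart : ∀ {a b} → even a ≡ false → even b ≡ false → 3 + a ≤ n → 3 + b ≤ n →
               secondBit a ≡ secondBit b → a ≢ b → 4 ≤ cycleDist n a b
  odds-apart {a} ea eb ra rb sa≡sb = cycleDist-≥-class ordered (ea , ra , refl) (eb , rb , sym sa≡sb)
    where
    Class : ℕ → Set
    Class x = even x ≡ false × 3 + x ≤ n × secondBit x ≡ secondBit a
    ordered : ∀ {x y} → Class x → Class y → x < y → 4 + x ≤ y × 4 + y ≤ n + x
    ordered {x} (ex , _ , sx) (ey , ry , sy) x<y =
      secondBit-gap ex ey (trans sx (sym sy)) x<y , ≤-trans (≤-reflexive (+-comm 1 _)) (+-mono-≤ ry (odd⇒≥1 ex))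

  odds-across : ∀ {a b} → even a ≡ false → even b ≡ false → 3 + a ≤ n → 3 + b ≤ n →
                secondBit a ≢ secondBit b → 3 ≤ cycleDist n a 1 + cycleDist n 0 b
  odds-across {a} {b} ea eb ra rb sa≢sb with odd⇒≡1⊎≥3 {a} ea
  ... | inj₁ refl = ≤-trans (cycleDist-from-0 b≥3 rb) (m≤n+m _ _)
    where
    b≥3 : 3 ≤ b
    b≥3 = odd∧secondBit⇒≥3 eb (¬-not (sa≢sb ∘ sym))
  ... | inj₂ a≥3 = +-mono-≤ (cycleDist-≥′ a≥3 (≤-trans (n≤1+n _) (≤-trans ra (m≤m+n n 1))))
                           (cycleDist-from-0 (odd⇒≥1 eb) (≤-trans (m≤n+m _ 2) rb))

  last-across : 3 ≤ cycleDist n (5 + K) 1 + cycleDist n 0 (5 + K)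
  last-across = +-mono-≤ (cycleDist-≥′ {n} {d = 2} (s≤s (s≤s (s≤s z≤n))) (≤-reflexive (+-comm 1 n)))
                         (cycleDist-from-0 (s≤s z≤n) ≤-refl)

  -- Colour₅ true reads (1 2 1 3)^(s+1) 1 4 and Colour₅ false reads (1 3 1 2)^(s+1) 1 5.
  data Colour₅ : Bool → ℕ → ℕ → Set where
    even₁ : ∀ {p a} → even a ≡ true → Colour₅ p a 1
    odd₂  : ∀ {p a} → even a ≡ false → 1 + a ≢ n → secondBit a ≡ not p → Colour₅ p a 2
    odd₃  : ∀ {p a} → even a ≡ false → 1 + a ≢ n → secondBit a ≡ p → Colour₅ p a 3
    last₄ : ∀ {a} → 1 + a ≡ n → Colour₅ true a 4
    last₅ : ∀ {a} → 1 + a ≡ n → Colour₅ false a 5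

  classify₅ : ∀ p a → ∃ (Colour₅ p a)
  classify₅ p a with even a in ea | 1 + a ≟ n | p | secondBit a ≟ᵇ p
  ... | true  | _          | _     | _        = 1 , even₁ ea
  ... | false | yes 1+a≡n  | true  | _        = 4 , last₄ 1+a≡n
  ... | false | yes 1+a≡n  | false | _        = 5 , last₅ 1+a≡n
  ... | false | no  1+a≢n  | _     | yes sa≡p = 3 , odd₃ ea 1+a≢n sa≡p
  ... | false | no  1+a≢n  | _     | no  sa≢p = 2 , odd₂ ea 1+a≢n (¬-not sa≢p)

  Colour₅-range : ∀ {p a c} → Colour₅ p a c → 1 ≤ c × c ≤ 5
  Colour₅-range (even₁ _)     = ≤-refl , s≤s z≤n
  Colour₅-range (odd₂ _ _ _)  = s≤s z≤n , s≤s (s≤s z≤n)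
  Colour₅-range (odd₃ _ _ _)  = s≤s z≤n , s≤s (s≤s (s≤s z≤n))
  Colour₅-range (last₄ _)     = s≤s z≤n , s≤s (s≤s (s≤s (s≤s z≤n)))
  Colour₅-range (last₅ _)     = s≤s z≤n , ≤-refl

  Colour₅-≤4 : ∀ {a c} → Colour₅ true a c → c ≤ 4
  Colour₅-≤4 (even₁ _)    = s≤s z≤n
  Colour₅-≤4 (odd₂ _ _ _) = s≤s (s≤s z≤n)
  Colour₅-≤4 (odd₃ _ _ _) = s≤s (s≤s (s≤s z≤n))
  Colour₅-≤4 (last₄ _)    = ≤-refl

  Colour₅-same-copy : ∀ {p a b c} → Colour₅ p a c → Colour₅ p b c → a < n → b < n → a ≢ b →
                      c < prodDist a 0 0 b
  Colour₅-same-copy (even₁ ea)         (even₁ eb)         a<n b<n a≢b = evens-apart a<n b<n ea eb a≢b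
  Colour₅-same-copy (odd₂ ea 1+a≢n sa) (odd₂ eb 1+b≢n sb) a<n b<n a≢b =
    ≤-trans (n≤1+n 3) (odds-apart ea eb (room-odd a<n ea 1+a≢n) (room-odd b<n eb 1+b≢n) (trans sa (sym sb)) a≢b)
  Colour₅-same-copy (odd₃ ea 1+a≢n sa) (odd₃ eb 1+b≢n sb) a<n b<n a≢b =
    odds-apart ea eb (room-odd a<n ea 1+a≢n) (room-odd b<n eb 1+b≢n) (trans sa (sym sb)) a≢b
  Colour₅-same-copy (last₄ refl)       (last₄ refl)       _   _   a≢b = contradiction refl a≢b
  Colour₅-same-copy (last₅ refl)       (last₅ refl)       _   _   a≢b = contradiction refl a≢b

  Colour₅-next-copy : ∀ {p q a b c} → Colour₅ p a c → Colour₅ q b c → q ≡ not p → a < n → b < n →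
                      c < prodDist a 0 1 b
  Colour₅-next-copy (even₁ ea) (even₁ _) _ a<n _ =
    s≤s (≤-trans (cycleDist-pos a<n 1<n (even⇒≢1 ea)) (m≤m+n _ _))
  Colour₅-next-copy (odd₂ ea 1+a≢n sa) (odd₂ eb 1+b≢n sb) q≡¬p a<n b<n =
    s≤s (≤-trans (n≤1+n 2) (odds-across ea eb (room-odd a<n ea 1+a≢n) (room-odd b<n eb 1+b≢n)
                                         λ sa≡sb → not-¬ (trans sa (sym q≡¬p)) (trans sa≡sb sb)))
  Colour₅-next-copy (odd₃ ea 1+a≢n sa) (odd₃ eb 1+b≢n sb) q≡¬p a<n b<n =
    s≤s (odds-across ea eb (room-odd a<n ea 1+a≢n) (room-odd b<n eb 1+b≢n)
                     λ sa≡sb → not-¬ sa (trans sa≡sb (trans sb q≡¬p)))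
  Colour₅-next-copy (last₄ _) (last₄ _) ()
  Colour₅-next-copy (last₅ _) (last₅ _) ()

  Colour₅-far-copy : ∀ {p q a b c} k → Colour₅ p a c → Colour₅ q b c → b < n → c < prodDist a 0 (2 + k) b
  Colour₅-far-copy {a = a} {b} k x y b<n = ≤-trans (bound x y) (prodDist-far a k b)
    where
    bound : ∀ {p q c} → Colour₅ p a c → Colour₅ q b c → c < 3 + (cycleDist n a 1 + cycleDist n 0 b)
    bound (even₁ _)    (even₁ _)       = s≤s (s≤s z≤n)
    bound (odd₂ _ _ _) (odd₂ _ _ _)    = s≤s (s≤s (s≤s z≤n))
    bound (odd₃ _ _ _) (odd₃ eb _ _)   =
      +-monoʳ-≤ 3 (≤-trans (cycleDist-from-0 (odd⇒≥1 eb) b<n) (m≤n+m _ _))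
    bound (last₄ refl) (last₄ refl)    = +-monoʳ-≤ 3 (≤-trans (n≤1+n 2) last-across)
    bound (last₅ refl) (last₅ refl)    = +-monoʳ-≤ 3 last-across

  -- Colour₀ reads (1 3 1 2)^s 1 3 2 1 4 2.
  data Colour₀ (a : ℕ) : ℕ → Set where
    even₁    : 5 + a ≤ n → even a ≡ true → Colour₀ a 1
    odd₂     : 5 + a ≤ n → even a ≡ false → secondBit a ≡ true → Colour₀ a 2
    odd₃     : 5 + a ≤ n → even a ≡ false → secondBit a ≡ false → Colour₀ a 3
    fromEnd₄ : 4 + a ≡ n → Colour₀ a 2
    fromEnd₃ : 3 + a ≡ n → Colour₀ a 1
    fromEnd₂ : 2 + a ≡ n → Colour₀ a 4
    fromEnd₁ : 1 + a ≡ n → Colour₀ a 2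

  classify₀ : ∀ a → a < n → ∃ (Colour₀ a)
  classify₀ a a<n with 1 + a ≟ n | 2 + a ≟ n | 3 + a ≟ n | 4 + a ≟ n
  ... | yes e | _     | _     | _     = 2 , fromEnd₁ e
  ... | no _  | yes e | _     | _     = 4 , fromEnd₂ e
  ... | no _  | no _  | yes e | _     = 1 , fromEnd₃ e
  ... | no _  | no _  | no _  | yes e = 2 , fromEnd₄ e
  ... | no ≢1 | no ≢2 | no ≢3 | no ≢4 = inner (≤∧≢⇒< (≤∧≢⇒< (≤∧≢⇒< (≤∧≢⇒< a<n ≢1) ≢2) ≢3) ≢4)
    where
    inner : 5 + a ≤ n → ∃ (Colour₀ a)
    inner room with even a in ea | secondBit a in sa
    ... | true  | _     = 1 , even₁ room ea
    ... | false | true  = 2 , odd₂ room ea sa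
    ... | false | false = 3 , odd₃ room ea sa

  Colour₀-range : ∀ {a c} → Colour₀ a c → 1 ≤ c × c ≤ 4
  Colour₀-range (even₁ _ _)  = ≤-refl , s≤s z≤n
  Colour₀-range (odd₂ _ _ _) = s≤s z≤n , s≤s (s≤s z≤n)
  Colour₀-range (odd₃ _ _ _) = s≤s z≤n , s≤s (s≤s (s≤s z≤n))
  Colour₀-range (fromEnd₄ _) = s≤s z≤n , s≤s (s≤s z≤n)
  Colour₀-range (fromEnd₃ _) = ≤-refl , s≤s z≤n
  Colour₀-range (fromEnd₂ _) = s≤s z≤n , ≤-refl
  Colour₀-range (fromEnd₁ _) = s≤s z≤n , s≤s (s≤s z≤n)

  room-odd₂ : ∀ {a} → 5 + a ≤ n → even a ≡ false → secondBit a ≡ true → 7 + a ≤ n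
  room-odd₂ {a} room ea sa = ≤∧≢⇒< (≤∧≢⇒< room not-n-5) not-n-6
    where
    not-n-5 : 5 + a ≢ n
    not-n-5 refl = not-¬ sa (secondBit-1+4* s)
    not-n-6 : 6 + a ≢ n
    not-n-6 refl = not-¬ ea (even-4* s)

  inner<n : ∀ {a} → 5 + a ≤ n → a < n
  inner<n {a} = ≤-trans (m≤n+m (suc a) 4)
  inner-room : ∀ {a} → 5 + a ≤ n → 3 + a ≤ n
  inner-room {a} = ≤-trans (m≤n+m (3 + a) 2)
  far-from-start : ∀ {a} → 5 + K ≤ n + a
  far-from-start {a} = ≤-trans (n≤1+n _) (m≤m+n n a)
  inner-vs-n-3 : ∀ {a} → 5 + a ≤ n → 2 ≤ cycleDist n a (3 + K)
  inner-vs-n-3 ra = cycleDist-≥ (≤-pred (≤-pred (≤-pred ra))) far-from-start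
  odd₂-vs-n-4 : ∀ {a} → 5 + a ≤ n → even a ≡ false → secondBit a ≡ true → 3 ≤ cycleDist n a (2 + K)
  odd₂-vs-n-4 ra ea sa = cycleDist-≥ (≤-pred (≤-pred (≤-pred (≤-pred (room-odd₂ ra ea sa))))) far-from-start
  odd₂-vs-n-1 : ∀ {a} → 5 + a ≤ n → even a ≡ false → secondBit a ≡ true → 3 ≤ cycleDist n a (5 + K)
  odd₂-vs-n-1 ra ea sa =
    cycleDist-≥ (≤-trans (≤-pred (≤-pred ra)) (n≤1+n _))
                (≤-trans (≤-reflexive (+-comm 2 n)) (+-monoʳ-≤ n (≤-trans (n≤1+n 2) (odd∧secondBit⇒≥3 ea sa))))
  n-4-vs-n-1 : 3 ≤ cycleDist n (2 + K) (5 + K)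
  n-4-vs-n-1 = cycleDist-≥ ≤-refl (+-monoʳ-≤ 6 (m≤n+m (2 + K) K))

  Colour₀-same-copy : ∀ {a b c} → Colour₀ a c → Colour₀ b c → a ≢ b → c < prodDist a 0 0 b
  Colour₀-same-copy (even₁ ra ea)   (even₁ rb eb)   a≢b = evens-apart (inner<n ra) (inner<n rb) ea eb a≢b
  Colour₀-same-copy (even₁ ra _)    (fromEnd₃ refl) _   = inner-vs-n-3 ra
  Colour₀-same-copy {b = b} (fromEnd₃ refl) (even₁ rb _) _ = cycleDist-flip (3 + K) b (inner-vs-n-3 rb)
  Colour₀-same-copy (odd₂ ra ea sa) (odd₂ rb eb sb) a≢b =
    ≤-trans (n≤1+n 3) (odds-apart ea eb (inner-room ra) (inner-room rb) (trans sa (sym sb)) a≢b)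
  Colour₀-same-copy (odd₂ ra ea sa) (fromEnd₄ refl) _   = odd₂-vs-n-4 ra ea sa
  Colour₀-same-copy {b = b} (fromEnd₄ refl) (odd₂ rb eb sb) _ = cycleDist-flip (2 + K) b (odd₂-vs-n-4 rb eb sb)
  Colour₀-same-copy (odd₂ ra ea sa) (fromEnd₁ refl) _   = odd₂-vs-n-1 ra ea sa
  Colour₀-same-copy {b = b} (fromEnd₁ refl) (odd₂ rb eb sb) _ = cycleDist-flip (5 + K) b (odd₂-vs-n-1 rb eb sb)
  Colour₀-same-copy (fromEnd₄ refl) (fromEnd₁ refl) _   = n-4-vs-n-1
  Colour₀-same-copy (fromEnd₁ refl) (fromEnd₄ refl) _   = cycleDist-flip (5 + K) (2 + K) n-4-vs-n-1
  Colour₀-same-copy (odd₃ ra ea sa) (odd₃ rb eb sb) a≢b =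
    odds-apart ea eb (inner-room ra) (inner-room rb) (trans sa (sym sb)) a≢b
  Colour₀-same-copy (fromEnd₄ refl) (fromEnd₄ refl) a≢b = contradiction refl a≢b
  Colour₀-same-copy (fromEnd₃ refl) (fromEnd₃ refl) a≢b = contradiction refl a≢b
  Colour₀-same-copy (fromEnd₂ refl) (fromEnd₂ refl) a≢b = contradiction refl a≢b
  Colour₀-same-copy (fromEnd₁ refl) (fromEnd₁ refl) a≢b = contradiction refl a≢b

  two-across : ∀ {a b} → a < n → a ≢ 1 → b < n → even b ≡ false → 2 ≤ cycleDist n a 1 + cycleDist n 0 b
  two-across a<n a≢1 b<n eb = +-mono-≤ (cycleDist-pos a<n 1<n a≢1) (cycleDist-from-0 (odd⇒≥1 eb) b<n)

  Colour₀-next-copy : ∀ {a b c} → Colour₀ a c → Colour₅ true b c → a < n → b < n → c < prodDist a 0 1 b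
  Colour₀-next-copy (even₁ _ ea)    (even₁ _)     a<n _   = s≤s (≤-trans (cycleDist-pos a<n 1<n (even⇒≢1 ea)) (m≤m+n _ _))
  Colour₀-next-copy (fromEnd₃ refl) (even₁ _)     a<n _   = s≤s (≤-trans (cycleDist-pos a<n 1<n λ ()) (m≤m+n _ _))
  Colour₀-next-copy (odd₂ _ _ sa)   (odd₂ eb _ _) a<n b<n = s≤s (two-across a<n (secondBit⇒≢1 sa) b<n eb)
  Colour₀-next-copy (fromEnd₄ refl) (odd₂ eb _ _) a<n b<n = s≤s (two-across a<n (λ ()) b<n eb)
  Colour₀-next-copy (fromEnd₁ refl) (odd₂ eb _ _) a<n b<n = s≤s (two-across a<n (λ ()) b<n eb)
  Colour₀-next-copy (odd₃ _ _ _)    (odd₃ eb 1+b≢n sb) _ b<n =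
    s≤s (≤-trans (cycleDist-from-0 (odd∧secondBit⇒≥3 eb sb) (room-odd b<n eb 1+b≢n)) (m≤n+m _ _))
  Colour₀-next-copy (fromEnd₂ refl) (last₄ refl)  _   _   =
    s≤s (+-mono-≤ (cycleDist-≥′ {n} {d = 3} (s≤s (s≤s (s≤s (s≤s z≤n)))) (≤-reflexive (+-comm 1 n)))
                  (cycleDist-from-0 (s≤s z≤n) ≤-refl))

  colouring₅ : ∀ {t} → Fin t × Fin n → ℕ
  colouring₅ (i , a) = proj₁ (classify₅ (even (toℕ i)) (toℕ a))

  colouring₅-separated : ∀ {t} → Separated t colouring₅
  colouring₅-separated {i = i} {j} {a} {b} zero j≡i+0 u≢v same
    with toℕ-injective {i = j} {i} (trans j≡i+0 (+-identityʳ (toℕ i)))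
  ... | refl = let x , y = sameClass (classify₅ _ (toℕ a)) (classify₅ _ (toℕ b)) same
               in Colour₅-same-copy x y (toℕ<n a) (toℕ<n b) (u≢v ∘ cong (i ,_) ∘ toℕ-injective)
  colouring₅-separated {i = i} {j} {a} {b} 1 j≡i+1 _ same =
    let x , y = sameClass (classify₅ _ (toℕ a)) (classify₅ _ (toℕ b)) same
    in Colour₅-next-copy x y parity (toℕ<n a) (toℕ<n b)
    where
    parity : even (toℕ j) ≡ not (even (toℕ i))
    parity = trans (cong even (trans j≡i+1 (+-comm (toℕ i) 1))) (even-suc (toℕ i))
  colouring₅-separated {a = a} {b = b} (suc (suc k)) _ _ same =
    let x , y = sameClass (classify₅ _ (toℕ a)) (classify₅ _ (toℕ b)) same
    in Colour₅-far-copy k x y (toℕ<n b)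

  colourable₅ : ∀ t → PackingColorable (PathCycleProd t n) 5
  colourable₅ t = Separated⇒PackingColorable colouring₅ range colouring₅-separated
    where
    range : ∀ v → 1 ≤ colouring₅ v × colouring₅ v ≤ 5
    range (i , a) = Colour₅-range (proj₂ (classify₅ (even (toℕ i)) (toℕ a)))

  colouring₂ : Fin 2 × Fin n → ℕ
  colouring₂ (zero , a)     = proj₁ (classify₀ (toℕ a) (toℕ<n a))
  colouring₂ (suc zero , a) = proj₁ (classify₅ true (toℕ a))

  colouring₂-separated : Separated 2 colouring₂
  colouring₂-separated {zero} {zero} {a} {b} _ refl u≢v same =
    let x , y = sameClass (classify₀ (toℕ a) _) (classify₀ (toℕ b) _) same
    in Colour₀-same-copy x y (u≢v ∘ cong (zero ,_) ∘ toℕ-injective)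
  colouring₂-separated {zero} {suc zero} {a} {b} _ refl _ same =
    let x , y = sameClass (classify₀ (toℕ a) _) (classify₅ true (toℕ b)) same
    in Colour₀-next-copy x y (toℕ<n a) (toℕ<n b)
  colouring₂-separated {suc zero} {suc zero} {a} {b} _ refl u≢v same =
    let x , y = sameClass (classify₅ true (toℕ a)) (classify₅ true (toℕ b)) same
    in Colour₅-same-copy x y (toℕ<n a) (toℕ<n b) (u≢v ∘ cong (suc zero ,_) ∘ toℕ-injective)
  colouring₂-separated {suc zero} {zero} _ ()

  colouring₂-range : ∀ v → 1 ≤ colouring₂ v × colouring₂ v ≤ 4
  colouring₂-range (zero , a)     = Colour₀-range (proj₂ (classify₀ (toℕ a) (toℕ<n a)))
  colouring₂-range (suc zero , a) = proj₁ (Colour₅-range x) , Colour₅-≤4 x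
    where x = proj₂ (classify₅ true (toℕ a))

  colourable₂ : PackingColorable (PathCycleProd 2 n) 4
  colourable₂ = Separated⇒PackingColorable colouring₂ colouring₂-range colouring₂-separated

-- No packing 3-colouring of C_n when n ≡ 2 (mod 4)

%-below-2n : ∀ {n} .{{_ : NonZero n}} x → x < n + n → x % n ≡ x ⊎ x % n + n ≡ x
%-below-2n {n} x x<2n with x <? n
... | yes x<n = inj₁ (m<n⇒m%n≡m x<n)
... | no  x≮n = inj₂ (begin
  x % n + n       ≡⟨ cong (_+ n) (m≤n⇒[n∸m]%m≡n%m n≤x) ⟨
  (x ∸ n) % n + n ≡⟨ cong (_+ n) (m<n⇒m%n≡m x∸n<n) ⟩
  x ∸ n + n       ≡⟨ m∸n+n≡m n≤x ⟩
  x               ∎)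
  where
  open ≡-Reasoning
  n≤x : n ≤ x
  n≤x = ≮⇒≥ x≮n
  x∸n<n : x ∸ n < n
  x∸n<n = subst (x ∸ n <_) (m+n∸n≡m n n) (∸-monoˡ-< {o = n + n} x<2n n≤x)

PackedWindow : ℕ → ℕ → ℕ → ℕ → Set
PackedWindow a b c d =
  (a ≡ b → a < 1) × (b ≡ c → b < 1) × (c ≡ d → c < 1) ×
  (a ≡ c → a < 2) × (b ≡ d → b < 2) × (a ≡ d → a < 3)

packedWindow? : ∀ a b c d → Dec (PackedWindow a b c d)
packedWindow? a b c d =
  (a ≟ b →-dec a <? 1) ×-dec (b ≟ c →-dec b <? 1) ×-dec (c ≟ d →-dec c <? 1) ×-dec
  (a ≟ c →-dec a <? 2) ×-dec (b ≟ d →-dec b <? 2) ×-dec (a ≟ d →-dec a <? 3)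

rotate : Fin 4 → Fin 4
rotate zero                   = # 1
rotate (suc zero)             = # 2
rotate (suc (suc zero))       = # 3
rotate (suc (suc (suc zero))) = # 0

rotate^ : ℕ → Fin 4 → Fin 4
rotate^ zero    x = x
rotate^ (suc k) x = rotate (rotate^ k x)

rotate⁴ : ∀ x → rotate^ 4 x ≡ x
rotate⁴ zero                   = refl
rotate⁴ (suc zero)             = refl
rotate⁴ (suc (suc zero))       = refl
rotate⁴ (suc (suc (suc zero))) = refl

rotate^-4* : ∀ s x → rotate^ (4 * s) x ≡ x
rotate^-4* zero    x = refl
rotate^-4* (suc s) x =
  trans (cong (λ k → rotate^ k x) (*-suc 4 s)) (trans (rotate⁴ (rotate^ (4 * s) x)) (rotate^-4* s x))

rotate²-≢ : ∀ x → rotate (rotate x) ≢ x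
rotate²-≢ zero                   ()
rotate²-≢ (suc zero)             ()
rotate²-≢ (suc (suc zero))       ()
rotate²-≢ (suc (suc (suc zero))) ()

-- Position of a window of three colours within the period 1 2 1 3.  The windows
-- 1 2 3, 1 3 2, 2 3 1 and 3 2 1, where a packing 3-colouring of a path leaves
-- that period, get the phases that keep it advancing by one per step.
phase : ℕ → ℕ → ℕ → Fin 4
phase 1 2 1 = # 0
phase 2 1 3 = # 1
phase 1 2 3 = # 1
phase 1 3 1 = # 2
phase 1 3 2 = # 2
phase 2 3 1 = # 2
phase 3 1 2 = # 3
phase 3 2 1 = # 3
phase _ _ _ = # 0

colour₃ : Fin 3 → ℕ
colour₃ i = suc (toℕ i)

phase-rotates₃ : ∀ a b c d → PackedWindow (colour₃ a) (colour₃ b) (colour₃ c) (colour₃ d) →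
                 phase (colour₃ b) (colour₃ c) (colour₃ d) ≡ rotate (phase (colour₃ a) (colour₃ b) (colour₃ c))
phase-rotates₃ = toWitness {a? = all? λ a → all? λ b → all? λ c → all? λ d →
  packedWindow? (colour₃ a) (colour₃ b) (colour₃ c) (colour₃ d) →-dec
  (phase (colour₃ b) (colour₃ c) (colour₃ d) ≟ᶠ rotate (phase (colour₃ a) (colour₃ b) (colour₃ c)))} _

as-colour₃ : ∀ {x} → 1 ≤ x × x ≤ 3 → ∃ λ i → colour₃ i ≡ x
as-colour₃ {1} _ = # 0 , refl
as-colour₃ {2} _ = # 1 , refl
as-colour₃ {3} _ = # 2 , refl
as-colour₃ {suc (suc (suc (suc _)))} (_ , s≤s (s≤s (s≤s ())))

phase-rotates : ∀ {a b c d} → 1 ≤ a × a ≤ 3 → 1 ≤ b × b ≤ 3 → 1 ≤ c × c ≤ 3 → 1 ≤ d × d ≤ 3 →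
                PackedWindow a b c d → phase b c d ≡ rotate (phase a b c)
phase-rotates ra rb rc rd with as-colour₃ ra | as-colour₃ rb | as-colour₃ rc | as-colour₃ rd
... | a , refl | b , refl | c , refl | d , refl = phase-rotates₃ a b c d

module CycleLowerBound (s : ℕ) where

  n : ℕ
  n = 6 + 4 * s

  pos : ℕ → Fin n
  pos k = k mod n

  toℕ-pos : ∀ k → toℕ (pos k) ≡ k % n
  toℕ-pos k = toℕ-fromℕ< (m%n<n k n)

  %-reduce : ∀ d k → d < n → (d + k) % n ≡ (d + k % n) % n
  %-reduce d k d<n = trans (%-distribˡ-+ d k n) (cong (λ y → (y + k % n) % n) (m<n⇒m%n≡m d<n))

  toℕ-pos-+ : ∀ d k → d < n → toℕ (pos (d + k)) ≡ d + toℕ (pos k) ⊎ toℕ (pos (d + k)) + n ≡ d + toℕ (pos k)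
  toℕ-pos-+ d k d<n rewrite toℕ-pos (d + k) | toℕ-pos k | %-reduce d k d<n =
    %-below-2n (d + k % n) (+-mono-< d<n (m%n<n k n))

  pos-step : ∀ k → ProdAdj 1 n (zero , pos k) (zero , pos (suc k))
  pos-step k with toℕ-pos-+ 1 k (s≤s (s≤s z≤n))
  ... | inj₁ e = cyc⁺ zero (pos k) (pos (suc k)) e
  ... | inj₂ e = wrap⁺ zero (pos k) (pos (suc k)) (trans (sym e) (cong (_+ n) wraps)) wraps
    where
    wraps : toℕ (pos (suc k)) ≡ 0
    wraps = n≤0⇒n≡0 (+-cancelʳ-≤ n _ 0 (subst (_≤ n) (sym e) (toℕ<n (pos k))))

  pos-≢ : ∀ k d → 0 < d → d < n → pos k ≢ pos (d + k)
  pos-≢ k (suc d) _ d<n same with toℕ-pos-+ (suc d) k d<n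
  ... | inj₁ e = m≢1+n+m (toℕ (pos k)) (trans (cong toℕ same) e)
  ... | inj₂ e = <-irrefl (sym n≡1+d) d<n
    where
    n≡1+d : n ≡ suc d
    n≡1+d = +-cancelˡ-≡ (toℕ (pos k)) n (suc d)
              (trans (trans (cong (λ y → toℕ y + n) same) e) (+-comm (suc d) (toℕ (pos k))))

  pos-periodic : ∀ j → pos (j + n) ≡ pos j
  pos-periodic j = toℕ-injective (trans (toℕ-pos (j + n)) (trans ([m+n]%n≡m%n j n) (sym (toℕ-pos j))))

  pos-walk : ∀ k d → Walk (PathCycleProd 1 n) (zero , pos k) (zero , pos (d + k)) d
  pos-walk k zero    = here
  pos-walk k (suc d) = Walk-snoc (pos-walk k d) (pos-step (d + k))

  no-packing-3 : ¬ PackingColorable (PathCycleProd 1 n) 3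
  no-packing-3 (c , range , far) = rotate²-≢ (phaseAt 0) full-turn
    where
    w : ℕ → ℕ
    w k = c (zero , pos k)

    close : ∀ j d → suc d ≤ 3 → w j ≡ w (suc d + j) → w j < suc d
    close j d d<3 same = far _ _ distinct same (pos-walk j (suc d))
      where
      distinct : (zero , pos j) ≢ (zero , pos (suc d + j))
      distinct = pos-≢ j (suc d) (s≤s z≤n) (≤-trans (s≤s d<3) (s≤s (s≤s (s≤s (s≤s z≤n))))) ∘ cong proj₂

    window : ∀ k → PackedWindow (w k) (w (1 + k)) (w (2 + k)) (w (3 + k))
    window k = close k 0 (s≤s z≤n) , close (1 + k) 0 (s≤s z≤n) , close (2 + k) 0 (s≤s z≤n) ,
               close k 1 (s≤s (s≤s z≤n)) , close (1 + k) 1 (s≤s (s≤s z≤n)) , close k 2 ≤-refl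

    phaseAt : ℕ → Fin 4
    phaseAt k = phase (w k) (w (1 + k)) (w (2 + k))

    phaseAt-rotates : ∀ k → phaseAt k ≡ rotate^ k (phaseAt 0)
    phaseAt-rotates zero    = refl
    phaseAt-rotates (suc k) =
      trans (phase-rotates (range _) (range _) (range _) (range _) (window k)) (cong rotate (phaseAt-rotates k))

    w-periodic : ∀ j → w (j + n) ≡ w j
    w-periodic j = cong (λ x → c (zero , x)) (pos-periodic j)

    full-turn : rotate (rotate (phaseAt 0)) ≡ phaseAt 0
    full-turn = begin
      rotate^ 2 (phaseAt 0)                   ≡⟨ cong (rotate^ 2) (rotate⁴ (phaseAt 0)) ⟨
      rotate^ 6 (phaseAt 0)                   ≡⟨ cong (rotate^ 6) (rotate^-4* s (phaseAt 0)) ⟨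
      rotate^ n (phaseAt 0)                   ≡⟨ phaseAt-rotates n ⟨
      phase (w n) (w (1 + n)) (w (2 + n))     ≡⟨ cong₂ (λ x y → phase x y (w (2 + n))) (w-periodic 0) (w-periodic 1) ⟩
      phase (w 0) (w 1) (w (2 + n))           ≡⟨ cong (phase (w 0) (w 1)) (w-periodic 2) ⟩
      phaseAt 0                               ∎
      where open ≡-Reasoning

4*[1+s]+2≡6+4*s : ∀ s → 4 * suc s + 2 ≡ 6 + 4 * s
4*[1+s]+2≡6+4*s s = trans (cong (_+ 2) (*-suc 4 s)) (cong (4 +_) (+-comm (4 * s) 2))

theorem7 : (t s : ℕ) → 1 ≤ t → 1 ≤ s →
    ((t ≤ 2 → PackingColorable (PathCycleProd t (4 * s + 2)) 4) ×
     (3 ≤ t → PackingColorable (PathCycleProd t (4 * s + 2)) 5)) ×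
    (t ≤ 2 → PackingChromaticNumberIs (PathCycleProd t (4 * s + 2)) 4)
theorem7 t zero    _   ()
theorem7 t (suc s) 1≤t _ rewrite 4*[1+s]+2≡6+4*s s =
  (colourable₄ , λ _ → colourable₅ t) , λ t≤2 → colourable₄ t≤2 , no-packing
  where
  open Colourings s using (colourable₂; colourable₅)
  colourable₄ : t ≤ 2 → PackingColorable (PathCycleProd t (6 + 4 * s)) 4
  colourable₄ t≤2 = PathCycleProd-mono t≤2 colourable₂
  no-packing : ∀ j → j < 4 → ¬ PackingColorable (PathCycleProd t (6 + 4 * s)) j
  no-packing j j<4 = CycleLowerBound.no-packing-3 s ∘ PathCycleProd-mono 1≤t ∘ PackingColorable-mono (≤-pred j<4)
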